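{- Let $P$ be a poset and let $X$ be a subset of $P$. Let $B\subseteq P$ be a connected non-empty subposet and let $\Gamma_B=\{C\in \Gamma(P,X) \mid B\subseteq C \}$. If $\Gamma_B$ is non-empty, then $\mathcal{I}_X(B)\neq \varnothing$ and $\Gamma_B$ has a minimum element (with respect to inclusion), namely the connected component of $\textnormal{st}_P(\mathcal{I}_X(B))$ that contains $B$. In particular, if $B\in\Gamma(P,X)$, then $\mathcal{I}_X(B)\neq \varnothing$ and $B$ is a connected component of $\textnormal{st}_P(\mathcal{I}_X(B))$.
   Context: For a poset $P$ and $a\in P$, $\textnormal{st}_P(a)=\{x\in P\mid x\leq a \text{ or } x\geq a\}$, and for non-empty $A\subseteq P$, $\textnormal{st}_P(A)=\bigcap_{a\in A}\textnormal{st}_P(a)$. Connected components are taken with respect to the comparability relation. The crosscut poset $\Gamma(P,X)$ is the set of connected components of the non-empty subposets $\textnormal{st}_P(A)$ with $A$ a non-empty subset of $X$, ordered by inclusion. For subsets $X,B\subseteq P$, $\mathcal{I}_X(B)=\{x\in X\mid B\subseteq \textnormal{st}_P(x)\}$. -}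

module Defs where

open import Level using (Level; suc)
open import Data.Product using (Σ; ∃; _×_; _,_)
open import Data.Sum using (_⊎_)
open import Relation.Unary using (Pred; _⊆_; _∈_)
open import Relation.Binary using (Rel)
open import Relation.Binary.Bundles using (Poset)
open import Relation.Binary.Construct.Closure.ReflexiveTransitive using (Star)

module _ {ℓ : Level} (P : Poset ℓ ℓ ℓ) where
  open Poset P

  Subset : Set (suc ℓ)
  Subset = Pred Carrier ℓ

  _≐_ : Subset → Subset → Set ℓ
  S ≐ T = (S ⊆ T) × (T ⊆ S)

  NonEmpty : Subset → Set ℓ
  NonEmpty S = ∃ λ x → S x

  Comparable : Rel Carrier ℓ
  Comparable x y = (x ≤ y) ⊎ (y ≤ x)

  st : Carrier → Subset
  st a x = Comparable x a

  -- st_P(A) = ⋂_{a ∈ A} st_P(a)   (used for non-empty A)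
  stSet : Subset → Subset
  stSet A x = ∀ a → A a → x ∈ st a

  CompIn : Subset → Rel Carrier ℓ
  CompIn S x y = S x × S y × Comparable x y

  Connected : Subset → Set ℓ
  Connected S = ∀ x y → S x → S y → Star (CompIn S) x y

  Component : Subset → Carrier → Subset
  Component S a x = S x × Star (CompIn S) a x

  IsComponentOf : Subset → Subset → Set ℓ
  IsComponentOf S C = ∃ λ a → S a × (C ≐ Component S a)

  Γ : Subset → Pred Subset (suc ℓ)
  Γ X C = ∃ λ (A : Subset) → (A ⊆ X) × NonEmpty A × IsComponentOf (stSet A) C

  I : Subset → Subset → Subset
  I X B x = X x × (B ⊆ st x)

-- If B lies in a member C of Γ(P,X) cut out by st(A), then every element of A is
-- comparable with all of B, so A ⊆ I_X(B).  Hence st(I_X(B)) ⊆ st(A), and the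
-- component of st(I_X(B)) through B sits inside the component of st(A) through B,
-- which is C.  Taking A = I_X(B) itself shows that this component belongs to Γ.

module Submission where

open import Defs
open import Level using (Level)
open import Data.Product using (_×_; ∃; _,_; proj₁)
open import Function using (id)
open import Relation.Unary using (_⊆_)
open import Relation.Binary.Bundles using (Poset)
open import Relation.Binary.Construct.Closure.ReflexiveTransitive using (Star; _◅◅_)
  renaming (map to Star-map)

module _ {ℓ : Level} (P : Poset ℓ ℓ ℓ) where

  open Poset P using (Carrier)

  CompIn-paths-mono : {S T : Subset P} → S ⊆ T →
                      ∀ {x y} → Star (CompIn P S) x y → Star (CompIn P T) x y
  CompIn-paths-mono S⊆T = Star-map λ { (Sx , Sy , x~y) → S⊆T Sx , S⊆T Sy , x~y }

  Component⊆ : (S : Subset P) (a : Carrier) → Component P S a ⊆ S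
  Component⊆ S a = proj₁

  Component-mono : {S T : Subset P} → S ⊆ T → ∀ a → Component P S a ⊆ Component P T a
  Component-mono S⊆T a (Sx , a⇝x) = S⊆T Sx , CompIn-paths-mono S⊆T a⇝x

  Component-shift : (S : Subset P) {a b : Carrier} →
                    Component P S a b → Component P S b ⊆ Component P S a
  Component-shift S (_ , a⇝b) (Sx , b⇝x) = Sx , a⇝b ◅◅ b⇝x

  Connected⇒⊆Component : {S T : Subset P} → Connected P S → S ⊆ T →
                         ∀ {b} → S b → S ⊆ Component P T b
  Connected⇒⊆Component conn S⊆T Sb Sy = S⊆T Sy , CompIn-paths-mono S⊆T (conn _ _ Sb Sy)

  stSet-antitone : {A A′ : Subset P} → A ⊆ A′ → stSet P A′ ⊆ stSet P A
  stSet-antitone A⊆A′ x∈st a Aa = x∈st a (A⊆A′ Aa)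

  Component-∈Γ : {X A : Subset P} → A ⊆ X → NonEmpty P A →
                 ∀ {b} → stSet P A b → Γ P X (Component P (stSet P A) b)
  Component-∈Γ A⊆X neA {b} stb = _ , A⊆X , neA , b , stb , (id , id)

  module _ (X B : Subset P) where

    ⊆stSet-I : B ⊆ stSet P (I P X B)
    ⊆stSet-I By x (_ , B⊆st-x) = B⊆st-x By

    ⊆stSet⇒⊆I : {A : Subset P} → A ⊆ X → B ⊆ stSet P A → A ⊆ I P X B
    ⊆stSet⇒⊆I A⊆X B⊆stA {x} Ax = A⊆X Ax , λ By → B⊆stA By x Ax

    Γ-witness⊆I : ∀ {C A} → A ⊆ X → IsComponentOf P (stSet P A) C → B ⊆ C → A ⊆ I P X B
    Γ-witness⊆I {A = A} A⊆X (a , _ , C⊆ , _) B⊆C =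
      ⊆stSet⇒⊆I A⊆X λ By → Component⊆ (stSet P A) a (C⊆ (B⊆C By))

    I-nonEmpty : ∀ {C} → Γ P X C → B ⊆ C → NonEmpty P (I P X B)
    I-nonEmpty (A , A⊆X , (x , Ax) , C-comp) B⊆C = x , Γ-witness⊆I A⊆X C-comp B⊆C Ax

    Component-I-minimal : ∀ {b} → B b → ∀ C → Γ P X C → B ⊆ C →
                          Component P (stSet P (I P X B)) b ⊆ C
    Component-I-minimal Bb C (A , A⊆X , _ , C-comp@(_ , _ , C⊆ , ⊆C)) B⊆C =
      λ x∈D → ⊆C (Component-shift (stSet P A) (C⊆ (B⊆C Bb))
                    (Component-mono (stSet-antitone (Γ-witness⊆I A⊆X C-comp B⊆C)) _ x∈D))

proposition3p9 : {ℓ : Level} (P : Poset ℓ ℓ ℓ) (X B : Subset P) →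
    NonEmpty P B → Connected P B →
    ((∃ λ (C₀ : Subset P) → Γ P X C₀ × (B ⊆ C₀)) →
    NonEmpty P (I P X B) ×
    (∀ b → B b →
    Γ P X (Component P (stSet P (I P X B)) b) ×
    (B ⊆ Component P (stSet P (I P X B)) b) ×
    (∀ C → Γ P X C → B ⊆ C → Component P (stSet P (I P X B)) b ⊆ C)))
    × (Γ P X B → NonEmpty P (I P X B) × IsComponentOf P (stSet P (I P X B)) B)
proposition3p9 P X B (b₀ , Bb₀) B-conn = minimum-of-Γ_B , B∈Γ⇒component
  where
    B⊆D : ∀ {b} → B b → B ⊆ Component P (stSet P (I P X B)) b
    B⊆D = Connected⇒⊆Component P B-conn (⊆stSet-I P X B)

    minimum-of-Γ_B : (∃ λ C₀ → Γ P X C₀ × (B ⊆ C₀)) →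
      NonEmpty P (I P X B) ×
      (∀ b → B b →
        Γ P X (Component P (stSet P (I P X B)) b) ×
        (B ⊆ Component P (stSet P (I P X B)) b) ×
        (∀ C → Γ P X C → B ⊆ C → Component P (stSet P (I P X B)) b ⊆ C))
    minimum-of-Γ_B (C₀ , C₀∈Γ , B⊆C₀) = I≠∅ , λ b Bb →
      Component-∈Γ P proj₁ I≠∅ (⊆stSet-I P X B Bb) , B⊆D Bb ,
      Component-I-minimal P X B Bb
      where
        I≠∅ : NonEmpty P (I P X B)
        I≠∅ = I-nonEmpty P X B C₀∈Γ B⊆C₀

    B∈Γ⇒component : Γ P X B → NonEmpty P (I P X B) × IsComponentOf P (stSet P (I P X B)) B
    B∈Γ⇒component B∈Γ = I-nonEmpty P X B B∈Γ id ,
      b₀ , ⊆stSet-I P X B Bb₀ , B⊆D Bb₀ , Component-I-minimal P X B Bb₀ B B∈Γ id
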